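{- Let $d$ be a positive integer and let $f$ be any $d$-tupling function. Then $f$ has cubic shells if and only if, for every integer $n>1$, $f$ has base-$n$ shells.
   Context: $\mathbb{N}$ denotes the non-negative integers. A $d$-tupling function is a bijection $f\colon\mathbb{N}^d\to\mathbb{N}$. A function $s\colon\mathbb{N}^d\to\mathbb{N}$ is a shell numbering for $f$ if for all $\mathbf{x},\mathbf{y}\in\mathbb{N}^d$, $s(\mathbf{x})<s(\mathbf{y})$ implies $f(\mathbf{x})<f(\mathbf{y})$. $f$ has cubic shells if $\max(x_1,\ldots,x_d)$ is a shell numbering for $f$. For an integer $n>1$ and $x\in\mathbb{N}$, $\operatorname{len}_n(x)=\lceil\log_n(x+1)\rceil$; $f$ has base-$n$ shells if $\max(\operatorname{len}_n(x_1),\ldots,\operatorname{len}_n(x_d))$ is a shell numbering for $f$. -}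

module Defs where

open import Data.Nat using (ℕ; zero; suc; _+_; _⊔_; _<_; _/_; NonZero; s≤s)
open import Data.Fin using (Fin)
open import Data.Vec.Functional using (Vector; foldr)
open import Function.Definitions using (Bijective)

Tuple : ℕ → Set
Tuple d = Fin d → ℕ

IsTupling : (d : ℕ) → (Tuple d → ℕ) → Set
IsTupling d f = Bijective {A = Tuple d} {B = ℕ} _≡_ _≡_ f
  where open import Relation.Binary.PropositionalEquality using (_≡_)

IsShellNumbering : (d : ℕ) → (Tuple d → ℕ) → (Tuple d → ℕ) → Set
IsShellNumbering d f s = ∀ (x y : Tuple d) → s x < s y → f x < f y

maxT : {d : ℕ} → Tuple d → ℕ
maxT x = foldr _⊔_ 0 x

-- len_n(x) = ⌈log_n(x+1)⌉ = number of base-n digits of x (len_n 0 = 0):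
-- len_n 0 = 0, len_n x = 1 + len_n (x / n) for x > 0.
-- Implemented with fuel; fuel x+1 suffices since x / n < x for n > 1, x > 0.
lenFuel : ℕ → (n : ℕ) → .{{NonZero n}} → ℕ → ℕ
lenFuel zero    n x       = 0
lenFuel (suc k) n zero    = 0
lenFuel (suc k) n (suc x) = suc (lenFuel k n (suc x / n))

len : (n : ℕ) → .{{NonZero n}} → ℕ → ℕ
len n x = lenFuel (suc x) n x

maxLen : {d : ℕ} → (n : ℕ) → .{{NonZero n}} → Tuple d → ℕ
maxLen n x = maxT (λ i → len n (x i))

HasCubicShells : (d : ℕ) → (Tuple d → ℕ) → Set
HasCubicShells d f = IsShellNumbering d f maxT

HasBaseShells : (d : ℕ) → (n : ℕ) → 1 < n → (Tuple d → ℕ) → Set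
HasBaseShells d (suc n) _ f = IsShellNumbering d f (maxLen (suc n))

module Submission where

-- Write ℓₙ = len n.  Two facts about ℓₙ drive everything:
--   (1) ℓₙ is monotone and ℓₙ 0 = 0, hence it commutes with the maximum of
--       a tuple: maxLen n x = ℓₙ (maxT x).  So the base-n shell numbering is
--       the cubic shell numbering post-composed with a monotone map.
--   (2) Distinct values are separated by some base: if a < b then
--       ℓₙ a < ℓₙ b for a suitable n > 1 (n = 2 if b = 1, and n = b if b ≥ 2,
--       where ℓ_b a ≤ 1 < 2 ≤ ℓ_b b).
-- A shell numbering s for f stays one when replaced by any t such that
-- t x < t y forces s x < s y.  By (1), maxLen n x < maxLen n y forces
-- maxT x < maxT y (monotone maps reflect <), giving cubic ⇒ base-n; by (1)
-- and (2), maxT x < maxT y forces maxLen n x < maxLen n y for a suitable n,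
-- giving (all bases) ⇒ cubic.

open import Defs
open import Data.Nat using (ℕ; zero; suc; _≤_; _<_; _⊔_; _/_; NonZero; z≤n; s≤s; ≢-nonZero⁻¹)
open import Data.Nat.Properties
  using (≤-refl; ≤-<-trans; <⇒≱; ≰⇒>; n≤0⇒n≡0; mono-≤-distrib-⊔)
open import Data.Nat.DivMod using (/-monoˡ-≤; m<n⇒m/n≡0; m≥n⇒m/n>0)
import Data.Fin as Fin
open import Data.Empty using (⊥-elim)
open import Data.Product using (Σ; _×_; _,_)
open import Relation.Binary.PropositionalEquality
  using (_≡_; refl; sym; cong; subst₂; module ≡-Reasoning)

shell-transfer : ∀ {d} {f s t : Tuple d → ℕ} →
  (∀ x y → t x < t y → s x < s y) →
  IsShellNumbering d f s → IsShellNumbering d f t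
shell-transfer t⇒s s-shell x y t< = s-shell x y (t⇒s x y t<)

mono-reflects-< : ∀ {h : ℕ → ℕ} → (∀ {a b} → a ≤ b → h a ≤ h b) →
  ∀ {a b} → h a < h b → a < b
mono-reflects-< mono h< = ≰⇒> (λ b≤a → <⇒≱ h< (mono b≤a))

-- A monotone map fixing 0 commutes with the maximum of a tuple
-- (0 is the maximum of the empty tuple).
mono-maxT : ∀ {h : ℕ → ℕ} → (∀ {a b} → a ≤ b → h a ≤ h b) → h 0 ≡ 0 →
  ∀ {d} (x : Tuple d) → h (maxT x) ≡ maxT (λ i → h (x i))
mono-maxT mono h0 {zero} x = h0
mono-maxT {h} mono h0 {suc d} x = begin
  h (x Fin.zero ⊔ maxT tail)        ≡⟨ mono-≤-distrib-⊔ mono (x Fin.zero) (maxT tail) ⟩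
  h (x Fin.zero) ⊔ h (maxT tail)    ≡⟨ cong (h (x Fin.zero) ⊔_) (mono-maxT mono h0 tail) ⟩
  h (x Fin.zero) ⊔ maxT (λ i → h (tail i)) ∎
  where
  open ≡-Reasoning
  tail : Tuple d
  tail i = x (Fin.suc i)

lenFuel-mono : ∀ n .{{_ : NonZero n}} {k k′ a b} → k ≤ k′ → a ≤ b →
  lenFuel k n a ≤ lenFuel k′ n b
lenFuel-mono n {zero}              _         _         = z≤n
lenFuel-mono n {suc k} {a = zero}  _         _         = z≤n
lenFuel-mono n {suc k} {suc k′} {suc a} {suc b} (s≤s k≤k′) (s≤s a≤b) =
  s≤s (lenFuel-mono n k≤k′ (/-monoˡ-≤ n (s≤s a≤b)))

-- Hence len n is monotone (run each side with its own default fuel).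
len-mono : ∀ n .{{_ : NonZero n}} {a b} → a ≤ b → len n a ≤ len n b
len-mono n a≤b = lenFuel-mono n (s≤s a≤b) a≤b

maxLen≡len-maxT : ∀ n .{{_ : NonZero n}} {d} (x : Tuple d) → maxLen n x ≡ len n (maxT x)
maxLen≡len-maxT n x = sym (mono-maxT (len-mono n) refl x)

len-below-base : ∀ n .{{_ : NonZero n}} {a} → a < n → len n a ≤ 1
len-below-base n {zero}  _   = z≤n
len-below-base n {suc a} a<n with suc a / n | m<n⇒m/n≡0 {suc a} {n} a<n
... | .0 | refl = s≤s z≤n

len-from-base : ∀ n .{{_ : NonZero n}} {b} → n ≤ b → 2 ≤ len n b
len-from-base n {zero}  n≤0 = ⊥-elim (≢-nonZero⁻¹ n (n≤0⇒n≡0 n≤0))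
len-from-base n {suc b} n≤b with suc b / n | m≥n⇒m/n>0 {suc b} {n} n≤b
... | suc _ | _ = s≤s (s≤s z≤n)

len-separates : ∀ {a b} → a < b → Σ ℕ λ m → 1 < suc m × len (suc m) a < len (suc m) b
len-separates {zero}  {suc zero}     _   = 1 , s≤s (s≤s z≤n) , s≤s z≤n
len-separates {suc a} {suc zero}     (s≤s ())
len-separates {a}     {suc (suc b)}  a<b =
  suc b , s≤s (s≤s z≤n) ,
  ≤-<-trans (len-below-base (suc (suc b)) a<b) (len-from-base (suc (suc b)) ≤-refl)

theorem2p6 : (d : ℕ) → 0 < d → (f : Tuple d → ℕ) → IsTupling d f →
    (HasCubicShells d f → ((n : ℕ) → (1<n : 1 < n) → HasBaseShells d n 1<n f))
    × (((n : ℕ) → (1<n : 1 < n) → HasBaseShells d n 1<n f) → HasCubicShells d f)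
theorem2p6 d _ f _ = cubic⇒base , base⇒cubic
  where
  base<⇒cube< : ∀ m x y → maxLen (suc m) x < maxLen (suc m) y → maxT x < maxT y
  base<⇒cube< m x y lt = mono-reflects-< (len-mono (suc m))
    (subst₂ _<_ (maxLen≡len-maxT (suc m) x) (maxLen≡len-maxT (suc m) y) lt)

  cubic⇒base : HasCubicShells d f → ((n : ℕ) → (1<n : 1 < n) → HasBaseShells d n 1<n f)
  cubic⇒base cubic (suc m) _ = shell-transfer (base<⇒cube< m) cubic

  base⇒cubic : ((n : ℕ) → (1<n : 1 < n) → HasBaseShells d n 1<n f) → HasCubicShells d f
  base⇒cubic base x y cube< with len-separates cube<
  ... | m , 1<m+1 , len< = base (suc m) 1<m+1 x y
    (subst₂ _<_ (sym (maxLen≡len-maxT (suc m) x)) (sym (maxLen≡len-maxT (suc m) y)) len<)
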